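{- Let $\mathfrak{g}_1,\dots,\mathfrak{g}_m$ be finite-dimensional simple Lie algebras over a large enough field $\mathbb{F}$, each of which is generated (as a Lie algebra) by two elements. Then $\mathfrak{g}_1\oplus\dots\oplus\mathfrak{g}_m$ is also generated by two elements. -}

module Defs where

open import Level using (Level; _⊔_) renaming (suc to lsuc)
open import Algebra.Bundles using (CommutativeRing)
open import Algebra.Core using (Op₂)
open import Algebra.Module.Bundles using (Module)
import Algebra.Module.Construct.DirectProduct as MProd
import Algebra.Module.Construct.Zero as MZero
open import Data.Nat using (ℕ; zero; suc)
open import Data.Fin using (Fin; zero; suc)
open import Data.Product using (Σ; ∃; _×_; _,_; proj₁; proj₂)
open import Data.Sum using (_⊎_)
open import Data.Unit.Polymorphic using (tt)
open import Relation.Nullary using (¬_)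
open import Relation.Binary.PropositionalEquality using (_≡_)

record Field (c ℓ : Level) : Set (lsuc (c ⊔ ℓ)) where
  field
    commutativeRing : CommutativeRing c ℓ
  open CommutativeRing commutativeRing public
  field
    0≉1     : ¬ (0# ≈ 1#)
    inverse : ∀ x → ¬ (x ≈ 0#) → ∃ λ y → x * y ≈ 1#

AtLeast : ∀ {c ℓ} → ℕ → Field c ℓ → Set (c ⊔ ℓ)
AtLeast N F = Σ (Fin N → Carrier) λ f → ∀ i j → f i ≈ f j → i ≡ j
  where open Field F

record LieAlgebra {c ℓ : Level} (F : Field c ℓ) (a ℓa : Level)
       : Set (c ⊔ ℓ ⊔ lsuc (a ⊔ ℓa)) where
  open Field F using (commutativeRing; Carrier)
  field
    module′ : Module commutativeRing a ℓa
  open Module module′ public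
  field
    [_,_]    : Op₂ Carrierᴹ
    []-cong  : ∀ {x x′ y y′} → x ≈ᴹ x′ → y ≈ᴹ y′ → [ x , y ] ≈ᴹ [ x′ , y′ ]
    []-+ˡ    : ∀ x y z → [ x +ᴹ y , z ] ≈ᴹ [ x , z ] +ᴹ [ y , z ]
    []-+ʳ    : ∀ x y z → [ x , y +ᴹ z ] ≈ᴹ [ x , y ] +ᴹ [ x , z ]
    []-*ˡ    : ∀ (r : Carrier) x y → [ r *ₗ x , y ] ≈ᴹ r *ₗ [ x , y ]
    []-*ʳ    : ∀ (r : Carrier) x y → [ x , r *ₗ y ] ≈ᴹ r *ₗ [ x , y ]
    []-alt   : ∀ x → [ x , x ] ≈ᴹ 0ᴹ
    jacobi   : ∀ x y z →
               ([ x , [ y , z ] ] +ᴹ [ y , [ z , x ] ]) +ᴹ [ z , [ x , y ] ] ≈ᴹ 0ᴹ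

module _ {c ℓ a ℓa : Level} {F : Field c ℓ} (L : LieAlgebra F a ℓa) where
  open Field F using (Carrier) renaming (0# to 0F)
  open LieAlgebra L

  linComb : ∀ {n} → (Fin n → Carrier) → (Fin n → Carrierᴹ) → Carrierᴹ
  linComb {zero}  r v = 0ᴹ
  linComb {suc n} r v = (r zero *ₗ v zero) +ᴹ linComb (λ i → r (suc i)) (λ i → v (suc i))

  SpannedBy : ℕ → Set (c ⊔ a ⊔ ℓa)
  SpannedBy d = Σ (Fin d → Carrierᴹ) λ b →
                  ∀ x → Σ (Fin d → Carrier) λ r → x ≈ᴹ linComb r b

  FiniteDimensional : Set (c ⊔ a ⊔ ℓa)
  FiniteDimensional = Σ ℕ SpannedBy

  data Generated (x y : Carrierᴹ) : Carrierᴹ → Set (c ⊔ a ⊔ ℓa) where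
    gen₁ : Generated x y x
    gen₂ : Generated x y y
    g-0  : Generated x y 0ᴹ
    g-+  : ∀ {u v} → Generated x y u → Generated x y v → Generated x y (u +ᴹ v)
    g-*  : ∀ r {u} → Generated x y u → Generated x y (r *ₗ u)
    g-[] : ∀ {u v} → Generated x y u → Generated x y v → Generated x y [ u , v ]
    g-≈  : ∀ {u v} → u ≈ᴹ v → Generated x y u → Generated x y v

  TwoGenerated : Set (c ⊔ a ⊔ ℓa)
  TwoGenerated = Σ Carrierᴹ λ x → Σ Carrierᴹ λ y → ∀ z → Generated x y z

  record IsIdeal {p} (I : Carrierᴹ → Set p) : Set (c ⊔ a ⊔ ℓa ⊔ p) where
    field
      resp-≈ : ∀ {u v} → u ≈ᴹ v → I u → I v
      has-0  : I 0ᴹ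
      clos-+ : ∀ {u v} → I u → I v → I (u +ᴹ v)
      clos-* : ∀ r {u} → I u → I (r *ₗ u)
      clos-[] : ∀ x {u} → I u → I [ x , u ]

  IsSimple : Set (lsuc (c ⊔ ℓ ⊔ a ⊔ ℓa))
  IsSimple =
    (Σ Carrierᴹ λ x → Σ Carrierᴹ λ y → ¬ ([ x , y ] ≈ᴹ 0ᴹ)) ×
    (∀ (I : Carrierᴹ → Set (c ⊔ ℓ ⊔ a ⊔ ℓa)) → IsIdeal I →
       (∀ u → I u → u ≈ᴹ 0ᴹ) ⊎ (∀ u → I u))

module _ {c ℓ : Level} {F : Field c ℓ} where
  open Field F using (commutativeRing)

  zeroLie : ∀ {a ℓa} → LieAlgebra F a ℓa
  zeroLie = record
    { module′ = MZero.⟨module⟩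
    ; [_,_] = λ _ _ → tt
    ; []-cong = λ _ _ → tt
    ; []-+ˡ = λ _ _ _ → tt
    ; []-+ʳ = λ _ _ _ → tt
    ; []-*ˡ = λ _ _ _ → tt
    ; []-*ʳ = λ _ _ _ → tt
    ; []-alt = λ _ → tt
    ; jacobi = λ _ _ _ → tt
    }

  _⊕_ : ∀ {a ℓa b ℓb} → LieAlgebra F a ℓa → LieAlgebra F b ℓb →
        LieAlgebra F (a ⊔ b) (ℓa ⊔ ℓb)
  L ⊕ M = record
    { module′ = MProd.⟨module⟩ L.module′ M.module′
    ; [_,_] = λ u v → L.[ proj₁ u , proj₁ v ] , M.[ proj₂ u , proj₂ v ]
    ; []-cong = λ p q → L.[]-cong (proj₁ p) (proj₁ q) , M.[]-cong (proj₂ p) (proj₂ q)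
    ; []-+ˡ = λ x y z → L.[]-+ˡ _ _ _ , M.[]-+ˡ _ _ _
    ; []-+ʳ = λ x y z → L.[]-+ʳ _ _ _ , M.[]-+ʳ _ _ _
    ; []-*ˡ = λ r x y → L.[]-*ˡ r _ _ , M.[]-*ˡ r _ _
    ; []-*ʳ = λ r x y → L.[]-*ʳ r _ _ , M.[]-*ʳ r _ _
    ; []-alt = λ x → L.[]-alt _ , M.[]-alt _
    ; jacobi = λ x y z → L.jacobi _ _ _ , M.jacobi _ _ _
    }
    where module L = LieAlgebra L; module M = LieAlgebra M

  ⨁ : ∀ {a ℓa} (m : ℕ) → (Fin m → LieAlgebra F a ℓa) → LieAlgebra F a ℓa
  ⨁ zero    g = zeroLie
  ⨁ (suc m) g = g zero ⊕ ⨁ m (λ i → g (suc i))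

-- Induction on m. It suffices that L ⊕ M is 2-generated when L is simple and generated by x, y,
-- M is generated by A, B and spanned by D vectors, and F has at least D + 2 elements. For t ≠ 0
-- let S_t be the subalgebra generated by (x, A) and (t y, B). The u with (u, 0) ∈ S_t form an
-- ideal of L, since every element of L is the first coordinate of an element of S_t; so by
-- simplicity it is 0 or L, and in the latter case S_t = L ⊕ M. Suppose it is 0 for D + 1 distinct
-- nonzero values of t. For every k there is a nonzero uₖ ∈ L that is homogeneous of degree k in y
-- (the elements of degree ≥ k span a nonzero ideal, and by the Leibniz rule they all vanish once
-- those of degree exactly k do). Each uₖ lifts to (tᵏ uₖ, wₖ) ∈ S_t with wₖ independent of t.
-- The D + 1 vectors w₀, …, w_D satisfy a nontrivial relation Σ rₖ wₖ = 0, so (Σ rₖ tᵏ uₖ, 0) ∈ S_t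
-- and the polynomial Σ rₖ tᵏ uₖ has D + 1 roots; hence every rₖ uₖ = 0, a contradiction. The uₖ
-- and the relation are only obtained under a double negation, which suffices because the goal of
-- that step is ⊥.

module Submission where

open import Defs
open import Level using (Level; _⊔_; Lift; lift; lower)
open import Data.Nat using (ℕ; zero; suc; _≤_; z≤n; s≤s; _≤?_; _≟_)
  renaming (_+_ to _+ℕ_; _*_ to _*ℕ_)
import Data.Nat.Properties as ℕ
open import Data.Fin using (Fin; zero; suc; _↑ˡ_; _↑ʳ_)
open import Data.Product using (Σ; ∃; _×_; _,_; proj₁; proj₂)
open import Data.Sum using (_⊎_; inj₁; inj₂; [_,_]′)
open import Function using (id)
open import Algebra.Bundles using (CommutativeMonoid)
open import Data.Empty using (⊥)
open import Data.Vec.Functional using (_++_)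
open import Data.Vec.Functional.Properties using (lookup-++ˡ; lookup-++ʳ)
open import Relation.Nullary using (¬_; yes; no)
open import Relation.Nullary.Negation using (contradiction; negated-stable; ¬¬-map)
open import Relation.Binary.PropositionalEquality using (_≡_; refl; subst)
import Relation.Binary.PropositionalEquality as ≡

module ¬¬-Monad where

  _>>=_ : ∀ {p q} {A : Set p} {B : Set q} → ¬ ¬ A → (A → ¬ ¬ B) → ¬ ¬ B
  m >>= f = negated-stable (¬¬-map f m)

  return : ∀ {p} {A : Set p} → A → ¬ ¬ A
  return = contradiction

  ¬¬-pull : ∀ {p} {n} {P : Fin n → Set p} → (∀ k → ¬ ¬ P k) → ¬ ¬ (∀ k → P k)
  ¬¬-pull {n = zero}  ¬¬P = return (λ ())
  ¬¬-pull {n = suc n} ¬¬P = do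
    P0 ← ¬¬P zero
    Psuc ← ¬¬-pull (λ k → ¬¬P (suc k))
    return λ where zero → P0 ; (suc k) → Psuc k

module LieAlgebraProperties {c ℓ a ℓa : Level} {F : Field c ℓ} (L : LieAlgebra F a ℓa) where
  open Field F using (Carrier; _≈_; _+_; -_; 1#; 0#; _*_; -‿inverseʳ; *-comm; inverse)
    renaming (trans to ≈-trans)
  open LieAlgebra L
  open import Relation.Binary.Reasoning.Setoid ≈ᴹ-setoid

  x+-1x≈0 : ∀ v → v +ᴹ - 1# *ₗ v ≈ᴹ 0ᴹ
  x+-1x≈0 v = begin
    v +ᴹ - 1# *ₗ v             ≈⟨ +ᴹ-congʳ (*ₗ-identityˡ v) ⟨
    1# *ₗ v +ᴹ - 1# *ₗ v       ≈⟨ *ₗ-distribʳ v 1# (- 1#) ⟨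
    (1# + - 1#) *ₗ v           ≈⟨ *ₗ-congʳ (-‿inverseʳ 1#) ⟩
    0# *ₗ v                    ≈⟨ *ₗ-zeroˡ v ⟩
    0ᴹ                         ∎

  x+y≈0⇒x≈-1y : ∀ {u v} → u +ᴹ v ≈ᴹ 0ᴹ → u ≈ᴹ - 1# *ₗ v
  x+y≈0⇒x≈-1y {u} {v} u+v≈0 = begin
    u                          ≈⟨ +ᴹ-identityʳ u ⟨
    u +ᴹ 0ᴹ                    ≈⟨ +ᴹ-congˡ (x+-1x≈0 v) ⟨
    u +ᴹ (v +ᴹ - 1# *ₗ v)      ≈⟨ +ᴹ-assoc u v _ ⟨
    (u +ᴹ v) +ᴹ - 1# *ₗ v      ≈⟨ +ᴹ-congʳ u+v≈0 ⟩
    0ᴹ +ᴹ - 1# *ₗ v            ≈⟨ +ᴹ-identityˡ _ ⟩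
    - 1# *ₗ v                  ∎

  *ₗ-cancelˡ : ∀ {r v} → ¬ r ≈ 0# → r *ₗ v ≈ᴹ 0ᴹ → v ≈ᴹ 0ᴹ
  *ₗ-cancelˡ {r} {v} r≉0 rv≈0 with inverse r r≉0
  ... | r⁻¹ , rr⁻¹≈1 = begin
    v                    ≈⟨ *ₗ-identityˡ v ⟨
    1# *ₗ v              ≈⟨ *ₗ-congʳ (≈-trans (*-comm r⁻¹ r) rr⁻¹≈1) ⟨
    (r⁻¹ * r) *ₗ v       ≈⟨ *ₗ-assoc r⁻¹ r v ⟩
    r⁻¹ *ₗ (r *ₗ v)      ≈⟨ *ₗ-congˡ rv≈0 ⟩
    r⁻¹ *ₗ 0ᴹ            ≈⟨ *ₗ-zeroʳ r⁻¹ ⟩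
    0ᴹ                   ∎

  []-zeroˡ : ∀ v → [ 0ᴹ , v ] ≈ᴹ 0ᴹ
  []-zeroˡ v = begin
    [ 0ᴹ , v ]           ≈⟨ []-cong (*ₗ-zeroˡ 0ᴹ) ≈ᴹ-refl ⟨
    [ 0# *ₗ 0ᴹ , v ]     ≈⟨ []-*ˡ 0# 0ᴹ v ⟩
    0# *ₗ [ 0ᴹ , v ]     ≈⟨ *ₗ-zeroˡ _ ⟩
    0ᴹ                   ∎

  []-zeroʳ : ∀ v → [ v , 0ᴹ ] ≈ᴹ 0ᴹ
  []-zeroʳ v = begin
    [ v , 0ᴹ ]           ≈⟨ []-cong ≈ᴹ-refl (*ₗ-zeroˡ 0ᴹ) ⟨
    [ v , 0# *ₗ 0ᴹ ]     ≈⟨ []-*ʳ 0# v 0ᴹ ⟩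
    0# *ₗ [ v , 0ᴹ ]     ≈⟨ *ₗ-zeroˡ _ ⟩
    0ᴹ                   ∎

  []-multiples : ∀ r s v → [ r *ₗ v , s *ₗ v ] ≈ᴹ 0ᴹ
  []-multiples r s v = begin
    [ r *ₗ v , s *ₗ v ]      ≈⟨ []-*ˡ r v _ ⟩
    r *ₗ [ v , s *ₗ v ]      ≈⟨ *ₗ-congˡ ([]-*ʳ s v v) ⟩
    r *ₗ (s *ₗ [ v , v ])    ≈⟨ *ₗ-congˡ (*ₗ-congˡ ([]-alt v)) ⟩
    r *ₗ (s *ₗ 0ᴹ)           ≈⟨ *ₗ-congˡ (*ₗ-zeroʳ s) ⟩
    r *ₗ 0ᴹ                  ≈⟨ *ₗ-zeroʳ r ⟩
    0ᴹ                       ∎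

  []-anticomm : ∀ u v → [ u , v ] ≈ᴹ - 1# *ₗ [ v , u ]
  []-anticomm u v = x+y≈0⇒x≈-1y (begin
    [ u , v ] +ᴹ [ v , u ]
      ≈⟨ +ᴹ-cong (+ᴹ-identityˡ _) (+ᴹ-identityʳ _) ⟨
    (0ᴹ +ᴹ [ u , v ]) +ᴹ ([ v , u ] +ᴹ 0ᴹ)
      ≈⟨ +ᴹ-cong (+ᴹ-congʳ ([]-alt u)) (+ᴹ-congˡ ([]-alt v)) ⟨
    ([ u , u ] +ᴹ [ u , v ]) +ᴹ ([ v , u ] +ᴹ [ v , v ])
      ≈⟨ +ᴹ-cong ([]-+ʳ u u v) ([]-+ʳ v u v) ⟨
    [ u , u +ᴹ v ] +ᴹ [ v , u +ᴹ v ]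
      ≈⟨ []-+ˡ u v (u +ᴹ v) ⟨
    [ u +ᴹ v , u +ᴹ v ]
      ≈⟨ []-alt _ ⟩
    0ᴹ ∎)

  []-leibniz : ∀ p q v → [ [ p , q ] , v ] ≈ᴹ [ p , [ q , v ] ] +ᴹ - 1# *ₗ [ q , [ p , v ] ]
  []-leibniz p q v = begin
    [ [ p , q ] , v ]                          ≈⟨ []-anticomm _ _ ⟩
    - 1# *ₗ [ v , [ p , q ] ]                  ≈⟨ x+y≈0⇒x≈-1y (jacobi p q v) ⟨
    [ p , [ q , v ] ] +ᴹ [ q , [ v , p ] ]     ≈⟨ +ᴹ-congˡ ([]-cong ≈ᴹ-refl ([]-anticomm v p)) ⟩
    [ p , [ q , v ] ] +ᴹ [ q , - 1# *ₗ [ p , v ] ]  ≈⟨ +ᴹ-congˡ ([]-*ʳ _ q _) ⟩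
    [ p , [ q , v ] ] +ᴹ - 1# *ₗ [ q , [ p , v ] ]  ∎

  ¬¬≈0-isIdeal : IsIdeal L (λ u → ¬ ¬ (u ≈ᴹ 0ᴹ))
  ¬¬≈0-isIdeal = record
    { resp-≈  = λ u≈v → ¬¬-map (≈ᴹ-trans (≈ᴹ-sym u≈v))
    ; has-0   = return ≈ᴹ-refl
    ; clos-+  = λ u≈0 v≈0 → do
        u≈0 ← u≈0
        v≈0 ← v≈0
        return (≈ᴹ-trans (+ᴹ-cong u≈0 v≈0) (+ᴹ-identityˡ 0ᴹ))
    ; clos-*  = λ r → ¬¬-map (λ u≈0 → ≈ᴹ-trans (*ₗ-congˡ u≈0) (*ₗ-zeroʳ r))
    ; clos-[] = λ x → ¬¬-map (λ u≈0 → ≈ᴹ-trans ([]-cong ≈ᴹ-refl u≈0) ([]-zeroʳ x))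
    }
    where open ¬¬-Monad

  module _ {v w : Carrierᴹ} where

    Generated-swap : ∀ {z} → Generated L v w z → Generated L w v z
    Generated-swap gen₁       = gen₂
    Generated-swap gen₂       = gen₁
    Generated-swap g-0        = g-0
    Generated-swap (g-+ g h)  = g-+ (Generated-swap g) (Generated-swap h)
    Generated-swap (g-* r g)  = g-* r (Generated-swap g)
    Generated-swap (g-[] g h) = g-[] (Generated-swap g) (Generated-swap h)
    Generated-swap (g-≈ e g)  = g-≈ e (Generated-swap g)

    Generated-by-multiple : w ≈ᴹ 0ᴹ → ∀ {z} → Generated L v w z → ∃ λ r → z ≈ᴹ r *ₗ v
    Generated-by-multiple w≈0 gen₁ = 1# , ≈ᴹ-sym (*ₗ-identityˡ v)
    Generated-by-multiple w≈0 gen₂ = 0# , ≈ᴹ-trans w≈0 (≈ᴹ-sym (*ₗ-zeroˡ v))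
    Generated-by-multiple w≈0 g-0  = 0# , ≈ᴹ-sym (*ₗ-zeroˡ v)
    Generated-by-multiple w≈0 (g-+ g h) with Generated-by-multiple w≈0 g | Generated-by-multiple w≈0 h
    ... | r , e | s , f = r + s , ≈ᴹ-trans (+ᴹ-cong e f) (≈ᴹ-sym (*ₗ-distribʳ v r s))
    Generated-by-multiple w≈0 (g-* t g) with Generated-by-multiple w≈0 g
    ... | r , e = t * r , ≈ᴹ-trans (*ₗ-congˡ e) (≈ᴹ-sym (*ₗ-assoc t r v))
    Generated-by-multiple w≈0 (g-[] g h) with Generated-by-multiple w≈0 g | Generated-by-multiple w≈0 h
    ... | r , e | s , f = 0# , ≈ᴹ-trans ([]-cong e f)
                                 (≈ᴹ-trans ([]-multiples r s v) (≈ᴹ-sym (*ₗ-zeroˡ v)))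
    Generated-by-multiple w≈0 (g-≈ e g) with Generated-by-multiple w≈0 g
    ... | r , f = r , ≈ᴹ-trans (≈ᴹ-sym e) f

    Generated-linComb : ∀ {n} (r : Fin n → Carrier) {z : Fin n → Carrierᴹ} →
                        (∀ k → Generated L v w (z k)) → Generated L v w (linComb L r z)
    Generated-linComb {zero}  r gz = g-0
    Generated-linComb {suc n} r gz =
      g-+ (g-* (r zero) (gz zero)) (Generated-linComb (λ k → r (suc k)) (λ k → gz (suc k)))

    simple⇒generator≉0 : (∀ z → Generated L v w z) → IsSimple L → ¬ w ≈ᴹ 0ᴹ
    simple⇒generator≉0 generates ((p , q , [p,q]≉0) , _) w≈0
      with Generated-by-multiple w≈0 (generates p) | Generated-by-multiple w≈0 (generates q)
    ... | r , p≈rv | s , q≈sv = [p,q]≉0 (≈ᴹ-trans ([]-cong p≈rv q≈sv) ([]-multiples r s v))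

-- Grading by the degree in the second generator

module Grading {c ℓ a ℓa : Level} {F : Field c ℓ} (L : LieAlgebra F a ℓa)
               (x y : LieAlgebra.Carrierᴹ L) where
  open LieAlgebra L
  open LieAlgebraProperties L
  open import Algebra.Properties.CommutativeSemigroup ℕ.+-commutativeSemigroup using (xy∙z≈y∙xz)

  data Homogeneous : ℕ → Carrierᴹ → Set (c ⊔ ℓ ⊔ a ⊔ ℓa) where
    h-x  : Homogeneous 0 x
    h-y  : Homogeneous 1 y
    h-0  : ∀ {n} → Homogeneous n 0ᴹ
    h-+  : ∀ {n u v} → Homogeneous n u → Homogeneous n v → Homogeneous n (u +ᴹ v)
    h-*  : ∀ {n} r {u} → Homogeneous n u → Homogeneous n (r *ₗ u)
    h-[] : ∀ {p q u v} → Homogeneous p u → Homogeneous q v → Homogeneous (p +ℕ q) [ u , v ]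
    h-≈  : ∀ {n u v} → u ≈ᴹ v → Homogeneous n u → Homogeneous n v

  data Degree≥ (j : ℕ) : Carrierᴹ → Set (c ⊔ ℓ ⊔ a ⊔ ℓa) where
    ge-hom : ∀ {n u} → j ≤ n → Homogeneous n u → Degree≥ j u
    ge-0   : Degree≥ j 0ᴹ
    ge-+   : ∀ {u v} → Degree≥ j u → Degree≥ j v → Degree≥ j (u +ᴹ v)
    ge-*   : ∀ r {u} → Degree≥ j u → Degree≥ j (r *ₗ u)
    ge-≈   : ∀ {u v} → u ≈ᴹ v → Degree≥ j u → Degree≥ j v

  []-Homogeneous-Degree≥ : ∀ {i j n u v} → i ≤ n → Homogeneous n u → Degree≥ j v →
                           Degree≥ (i +ℕ j) [ u , v ]
  []-Homogeneous-Degree≥ i≤n hu (ge-hom j≤m hv) = ge-hom (ℕ.+-mono-≤ i≤n j≤m) (h-[] hu hv)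
  []-Homogeneous-Degree≥ i≤n hu ge-0 = ge-≈ (≈ᴹ-sym ([]-zeroʳ _)) ge-0
  []-Homogeneous-Degree≥ i≤n hu (ge-+ h h′) = ge-≈ (≈ᴹ-sym ([]-+ʳ _ _ _))
    (ge-+ ([]-Homogeneous-Degree≥ i≤n hu h) ([]-Homogeneous-Degree≥ i≤n hu h′))
  []-Homogeneous-Degree≥ i≤n hu (ge-* r h) = ge-≈ (≈ᴹ-sym ([]-*ʳ r _ _))
    (ge-* r ([]-Homogeneous-Degree≥ i≤n hu h))
  []-Homogeneous-Degree≥ i≤n hu (ge-≈ e h) = ge-≈ ([]-cong ≈ᴹ-refl e) ([]-Homogeneous-Degree≥ i≤n hu h)

  []-Degree≥ : ∀ {i j u v} → Degree≥ i u → Degree≥ j v → Degree≥ (i +ℕ j) [ u , v ]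
  []-Degree≥ (ge-hom i≤n hu) hv = []-Homogeneous-Degree≥ i≤n hu hv
  []-Degree≥ ge-0 hv = ge-≈ (≈ᴹ-sym ([]-zeroˡ _)) ge-0
  []-Degree≥ (ge-+ h h′) hv = ge-≈ (≈ᴹ-sym ([]-+ˡ _ _ _)) (ge-+ ([]-Degree≥ h hv) ([]-Degree≥ h′ hv))
  []-Degree≥ (ge-* r h) hv = ge-≈ (≈ᴹ-sym ([]-*ˡ r _ _)) (ge-* r ([]-Degree≥ h hv))
  []-Degree≥ (ge-≈ e h) hv = ge-≈ ([]-cong e ≈ᴹ-refl) ([]-Degree≥ h hv)

  Generated⇒Degree≥0 : ∀ {z} → Generated L x y z → Degree≥ 0 z
  Generated⇒Degree≥0 gen₁       = ge-hom z≤n h-x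
  Generated⇒Degree≥0 gen₂       = ge-hom z≤n h-y
  Generated⇒Degree≥0 g-0        = ge-0
  Generated⇒Degree≥0 (g-+ g h)  = ge-+ (Generated⇒Degree≥0 g) (Generated⇒Degree≥0 h)
  Generated⇒Degree≥0 (g-* r g)  = ge-* r (Generated⇒Degree≥0 g)
  Generated⇒Degree≥0 (g-[] g h) = []-Degree≥ (Generated⇒Degree≥0 g) (Generated⇒Degree≥0 h)
  Generated⇒Degree≥0 (g-≈ e g)  = ge-≈ e (Generated⇒Degree≥0 g)

  Degree≥-isIdeal : (∀ z → Generated L x y z) → ∀ j → IsIdeal L (Degree≥ j)
  Degree≥-isIdeal generates j = record
    { resp-≈ = ge-≈ ; has-0 = ge-0 ; clos-+ = ge-+ ; clos-* = ge-*
    ; clos-[] = λ z → []-Degree≥ (Generated⇒Degree≥0 (generates z))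
    }

  -- By the Leibniz rule a bracket of degree ≥ k is rewritten, through brackets with ever
  -- smaller left factors, into brackets whose right factor already has degree ≥ k.
  module _ {p} (P : Carrierᴹ → Set p) (P-ideal : IsIdeal L P) (k : ℕ)
           (Homogeneous⊆P : ∀ {u} → Homogeneous k u → P u) where
    open IsIdeal P-ideal

    []∈P : ∀ {p u} → Homogeneous p u → ∀ {q v} → Homogeneous q v → (k ≤ q → P v) →
           k ≤ p +ℕ q → P [ u , v ]
    []∈P-low : ∀ {p u} → Homogeneous p u → ∀ {q v} → Homogeneous q v → (k ≤ q → P v) →
               k ≤ p +ℕ q → ¬ k ≤ q → ¬ p +ℕ q ≡ k → P [ u , v ]

    []∈P {p} hu {q} hv v∈P k≤p+q with k ≤? q | p +ℕ q ≟ k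
    ... | yes k≤q | _          = clos-[] _ (v∈P k≤q)
    ... | no k≰q  | yes p+q≡k  = Homogeneous⊆P (subst (λ n → Homogeneous n _) p+q≡k (h-[] hu hv))
    ... | no k≰q  | no p+q≢k   = []∈P-low hu hv v∈P k≤p+q k≰q p+q≢k

    []∈P-low h-x hv v∈P k≤q k≰q _ = contradiction k≤q k≰q
    []∈P-low h-y {q} hv v∈P k≤1+q k≰q 1+q≢k with ℕ.m≤n⇒m<n∨m≡n k≤1+q
    ... | inj₁ (s≤s k≤q) = contradiction k≤q k≰q
    ... | inj₂ k≡1+q     = contradiction (≡.sym k≡1+q) 1+q≢k
    []∈P-low h-0 hv v∈P _ _ _ = resp-≈ (≈ᴹ-sym ([]-zeroˡ _)) has-0
    []∈P-low (h-+ h h′) hv v∈P k≤p+q _ _ =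
      resp-≈ (≈ᴹ-sym ([]-+ˡ _ _ _)) (clos-+ ([]∈P h hv v∈P k≤p+q) ([]∈P h′ hv v∈P k≤p+q))
    []∈P-low (h-* r h) hv v∈P k≤p+q _ _ =
      resp-≈ (≈ᴹ-sym ([]-*ˡ r _ _)) (clos-* r ([]∈P h hv v∈P k≤p+q))
    []∈P-low (h-[] {p₁} {p₂} h₁ h₂) {q} hv v∈P k≤p+q _ _ =
      resp-≈ (≈ᴹ-sym ([]-leibniz _ _ _))
        (clos-+ ([]∈P h₁ (h-[] h₂ hv) ([]∈P h₂ hv v∈P)
                      (subst (k ≤_) (ℕ.+-assoc p₁ p₂ q) k≤p+q))
                (clos-* _ ([]∈P h₂ (h-[] h₁ hv) ([]∈P h₁ hv v∈P)
                      (subst (k ≤_) (xy∙z≈y∙xz p₁ p₂ q) k≤p+q))))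
    []∈P-low (h-≈ e h) hv v∈P k≤p+q _ _ = resp-≈ ([]-cong e ≈ᴹ-refl) ([]∈P h hv v∈P k≤p+q)

    Homogeneous≥⇒∈P : 1 ≤ k → ∀ {n w} → Homogeneous n w → k ≤ n → P w
    Homogeneous≥⇒∈P (s≤s _) h-x ()
    Homogeneous≥⇒∈P 1≤k h-y k≤1 = Homogeneous⊆P (subst (λ n → Homogeneous n y) (ℕ.≤-antisym 1≤k k≤1) h-y)
    Homogeneous≥⇒∈P 1≤k h-0 _ = has-0
    Homogeneous≥⇒∈P 1≤k (h-+ h h′) k≤n =
      clos-+ (Homogeneous≥⇒∈P 1≤k h k≤n) (Homogeneous≥⇒∈P 1≤k h′ k≤n)
    Homogeneous≥⇒∈P 1≤k (h-* r h) k≤n = clos-* r (Homogeneous≥⇒∈P 1≤k h k≤n)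
    Homogeneous≥⇒∈P 1≤k (h-[] hu hv) k≤n = []∈P hu hv (Homogeneous≥⇒∈P 1≤k hv) k≤n
    Homogeneous≥⇒∈P 1≤k (h-≈ e h) k≤n = resp-≈ e (Homogeneous≥⇒∈P 1≤k h k≤n)

    Degree≥⇒∈P : 1 ≤ k → ∀ {u} → Degree≥ k u → P u
    Degree≥⇒∈P 1≤k (ge-hom k≤n h) = Homogeneous≥⇒∈P 1≤k h k≤n
    Degree≥⇒∈P 1≤k ge-0           = has-0
    Degree≥⇒∈P 1≤k (ge-+ h h′)    = clos-+ (Degree≥⇒∈P 1≤k h) (Degree≥⇒∈P 1≤k h′)
    Degree≥⇒∈P 1≤k (ge-* r h)     = clos-* r (Degree≥⇒∈P 1≤k h)
    Degree≥⇒∈P 1≤k (ge-≈ e h)     = resp-≈ e (Degree≥⇒∈P 1≤k h)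

  module _ (generates : ∀ z → Generated L x y z) (simple : IsSimple L) where
    private
      p = proj₁ (proj₁ simple)
      q = proj₁ (proj₂ (proj₁ simple))
      [p,q]≉0 = proj₂ (proj₂ (proj₁ simple))

    Degree≥-full : ∀ j u → Degree≥ (suc j) u
    Degree≥-full zero with proj₂ simple (Degree≥ 1) (Degree≥-isIdeal generates 1)
    ... | inj₁ Degree≥1≈0 =
      contradiction (Degree≥1≈0 y (ge-hom ℕ.≤-refl h-y)) (simple⇒generator≉0 generates simple)
    ... | inj₂ full = full
    Degree≥-full (suc j) with proj₂ simple (Degree≥ (suc (suc j))) (Degree≥-isIdeal generates _)
    ... | inj₁ Degree≥2+j≈0 =
      contradiction (Degree≥2+j≈0 _ ([]-Degree≥ (Degree≥-full zero p) (Degree≥-full j q))) [p,q]≉0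
    ... | inj₂ full = full

    homogeneous-nonzero : ∀ k → ¬ ¬ (∃ λ u → Homogeneous k u × ¬ u ≈ᴹ 0ᴹ)
    homogeneous-nonzero zero = return (x , h-x , simple⇒generator≉0 (λ z → Generated-swap (generates z)) simple)
      where open ¬¬-Monad
    homogeneous-nonzero (suc k) no-witness = p≈0 (λ p≈0 →
        [p,q]≉0 (≈ᴹ-trans ([]-cong p≈0 ≈ᴹ-refl) ([]-zeroˡ q)))
      where
      p≈0 : ¬ ¬ p ≈ᴹ 0ᴹ
      p≈0 = Degree≥⇒∈P _ ¬¬≈0-isIdeal (suc k) (λ {u} h u≉0 → no-witness (u , h , u≉0))
                       (s≤s z≤n) (Degree≥-full k p)

module LinearAlgebra {c ℓ : Level} (F : Field c ℓ) where
  open Field F hiding (zero)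
  open import Algebra.Properties.Semiring.Sum semiring
    using (sum; sum-cong-≋; ∑-distrib-+; *-distribʳ-sum; sum-replicate-zero)
  open import Algebra.Properties.Ring ring using (-‿distribˡ-*; -‿distribʳ-*)
  open import Algebra.Properties.AbelianGroup +-abelianGroup using (ε⁻¹≈ε; ⁻¹-∙-comm)
  open import Algebra.Properties.CommutativeSemigroup *-commutativeSemigroup using (xy∙z≈y∙xz)
  open import Data.Fin using (punchIn; punchOut)
  open import Data.Fin.Properties using (punchIn-punchOut) renaming (_≟_ to _≟ᶠ_)
  open import Relation.Nullary.Decidable using (¬¬-excluded-middle)
  open import Relation.Binary.Reasoning.Setoid setoid
  open ¬¬-Monad

  x*y≉0 : ∀ {x y} → ¬ x ≈ 0# → ¬ y ≈ 0# → ¬ x * y ≈ 0#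
  x*y≉0 {x} {y} x≉0 y≉0 xy≈0 with inverse x x≉0
  ... | x⁻¹ , xx⁻¹≈1 = y≉0 (begin
    y               ≈⟨ *-identityˡ y ⟨
    1# * y          ≈⟨ *-congʳ (trans (sym xx⁻¹≈1) (*-comm x x⁻¹)) ⟩
    (x⁻¹ * x) * y   ≈⟨ *-assoc x⁻¹ x y ⟩
    x⁻¹ * (x * y)   ≈⟨ *-congˡ xy≈0 ⟩
    x⁻¹ * 0#        ≈⟨ zeroʳ x⁻¹ ⟩
    0#              ∎)

  sum-neg : ∀ {n} (f : Fin n → Carrier) → sum (λ k → - f k) ≈ - sum f
  sum-neg {zero}  f = sym ε⁻¹≈ε
  sum-neg {suc n} f = trans (+-congˡ (sum-neg (λ k → f (suc k)))) (⁻¹-∙-comm _ _)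

  ¬¬-all≈0⊎nonzero : ∀ {n} (f : Fin n → Carrier) → ¬ ¬ ((∀ j → f j ≈ 0#) ⊎ ∃ λ j → ¬ f j ≈ 0#)
  ¬¬-all≈0⊎nonzero f = do
    no none ← ¬¬-excluded-middle {A = ∃ λ j → ¬ f j ≈ 0#}
      where yes some → return (inj₂ some)
    all ← ¬¬-pull (λ j f≉0 → none (j , f≉0))
    return (inj₁ all)

  -- a k is the coefficient of the k-th row; column j is the j-th equation.
  NontrivialSolution : ∀ {n e} → (Fin n → Fin e → Carrier) → Set (c ⊔ ℓ)
  NontrivialSolution {n} M = Σ (Fin n → Carrier) λ a →
    (∃ λ k → ¬ a k ≈ 0#) × (∀ j → sum (λ k → a k * M k j) ≈ 0#)

  module Pivot {e} (M : Fin (suc (suc e)) → Fin (suc e) → Carrier)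
               (j₀ : Fin (suc e)) (p≉0 : ¬ M zero j₀ ≈ 0#) where
    p : Carrier
    p = M zero j₀

    -- Gaussian elimination with pivot M 0 j₀: column j₀ of these rows vanishes and is dropped.
    eliminated : Fin (suc e) → Fin e → Carrier
    eliminated k j = p * M (suc k) (punchIn j₀ j) - M (suc k) j₀ * M zero (punchIn j₀ j)

    extend : NontrivialSolution eliminated → NontrivialSolution M
    extend (a′ , (k , a′k≉0) , a′-solves) = a , (suc k , x*y≉0 p≉0 a′k≉0) , a-solves
      where
      pivotColumn : Fin (suc e) → Carrier
      pivotColumn k = M (suc k) j₀

      S : Carrier
      S = sum (λ k → a′ k * pivotColumn k)

      a : Fin (suc (suc e)) → Carrier
      a zero    = - S
      a (suc k) = p * a′ k

      a-solves : ∀ j → sum (λ k → a k * M k j) ≈ 0#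
      a-solves j with j ≟ᶠ j₀
      ... | yes refl = begin
        - S * p + sum (λ k → (p * a′ k) * pivotColumn k)
          ≈⟨ +-congˡ (sum-cong-≋ {suc e} λ k → trans (*-assoc p (a′ k) (pivotColumn k)) (*-comm p _)) ⟩
        - S * p + sum (λ k → (a′ k * pivotColumn k) * p)
          ≈⟨ +-congˡ (*-distribʳ-sum p (λ k → a′ k * pivotColumn k)) ⟨
        - S * p + S * p
          ≈⟨ distribʳ p (- S) S ⟨
        (- S + S) * p
          ≈⟨ *-congʳ (-‿inverseˡ S) ⟩
        0# * p
          ≈⟨ zeroˡ p ⟩
        0# ∎
      ... | no j≢j₀ = begin
        - S * Z + sum (λ k → (p * a′ k) * X k)
          ≈⟨ +-comm _ _ ⟩
        sum (λ k → (p * a′ k) * X k) + - S * Z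
          ≈⟨ +-congˡ (-‿distribˡ-* S Z) ⟨
        sum (λ k → (p * a′ k) * X k) + - (S * Z)
          ≈⟨ +-congˡ (-‿cong (*-distribʳ-sum Z (λ k → a′ k * pivotColumn k))) ⟩
        sum (λ k → (p * a′ k) * X k) + - sum (λ k → (a′ k * pivotColumn k) * Z)
          ≈⟨ +-congˡ (sum-neg (λ k → (a′ k * pivotColumn k) * Z)) ⟨
        sum (λ k → (p * a′ k) * X k) + sum (λ k → - ((a′ k * pivotColumn k) * Z))
          ≈⟨ ∑-distrib-+ (λ k → (p * a′ k) * X k) (λ k → - ((a′ k * pivotColumn k) * Z)) ⟨
        sum (λ k → (p * a′ k) * X k + - ((a′ k * pivotColumn k) * Z))
          ≈⟨ sum-cong-≋ {suc e} (λ k → factor (a′ k) (X k) (pivotColumn k)) ⟩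
        sum (λ k → a′ k * (p * X k - pivotColumn k * Z))
          ≈⟨ subst (λ j → sum (λ k → a′ k * (p * M (suc k) j - pivotColumn k * M zero j)) ≈ 0#)
                   (punchIn-punchOut j₀≢j) (a′-solves (punchOut j₀≢j)) ⟩
        0# ∎
        where
        j₀≢j = λ j₀≡j → j≢j₀ (≡.sym j₀≡j)
        Z = M zero j
        X = λ k → M (suc k) j
        factor : ∀ a x m → (p * a) * x + - ((a * m) * Z) ≈ a * (p * x - m * Z)
        factor a x m = begin
          (p * a) * x + - ((a * m) * Z)   ≈⟨ +-cong (xy∙z≈y∙xz p a x) (-‿cong (*-assoc a m Z)) ⟩
          a * (p * x) + - (a * (m * Z))   ≈⟨ +-congˡ (-‿distribʳ-* a (m * Z)) ⟩
          a * (p * x) + a * - (m * Z)     ≈⟨ distribˡ a (p * x) (- (m * Z)) ⟨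
          a * (p * x - m * Z)             ∎

  underdetermined-solvable : ∀ e (M : Fin (suc e) → Fin e → Carrier) → ¬ ¬ NontrivialSolution M
  underdetermined-solvable zero M = return ((λ _ → 1#) , (zero , λ 1≈0 → 0≉1 (sym 1≈0)) , λ ())
  underdetermined-solvable (suc e) M = do
    inj₂ (j₀ , p≉0) ← ¬¬-all≈0⊎nonzero (M zero)
      where inj₁ row₀≈0 → return (first-row-only row₀≈0)
    solution ← underdetermined-solvable e (Pivot.eliminated M j₀ p≉0)
    return (Pivot.extend M j₀ p≉0 solution)
    where
    first-row-only : (∀ j → M zero j ≈ 0#) → NontrivialSolution M
    first-row-only row₀≈0 = a , (zero , λ 1≈0 → 0≉1 (sym 1≈0)) , λ j →
      trans (+-cong (trans (*-identityˡ _) (row₀≈0 j))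
                    (trans (sum-cong-≋ {suc e} λ k → zeroˡ (M (suc k) j)) (sum-replicate-zero (suc e))))
            (+-identityˡ 0#)
      where
      a : Fin (suc (suc e)) → Carrier
      a zero    = 1#
      a (suc k) = 0#

-- Linear combinations and polynomials with coefficients in a Lie algebra

module LinearCombinations {c ℓ a ℓa : Level} {F : Field c ℓ} (L : LieAlgebra F a ℓa) where
  open Field F using (Carrier; _≈_; _+_; _*_; _-_; 0#; semiring) renaming (refl to ≈-refl)
  open LieAlgebra L
  open LieAlgebraProperties L using (*ₗ-cancelˡ)
  open LinearAlgebra F using (underdetermined-solvable)
  open import Algebra.Properties.Semiring.Sum semiring using (sum)
  open import Algebra.Properties.Semiring.Exp semiring using (_^_)
  open import Algebra.Properties.AbelianGroup (Field.+-abelianGroup F) using (x∙y⁻¹≈ε⇒x≈y; //-rightDividesˡ)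
  open import Algebra.Properties.CommutativeSemigroup (CommutativeMonoid.commutativeSemigroup +ᴹ-commutativeMonoid)
    using (interchange)
  open import Data.Fin using (toℕ)
  open import Relation.Binary.Reasoning.Setoid ≈ᴹ-setoid
  open ¬¬-Monad

  linComb-cong : ∀ {n} {r s : Fin n → Carrier} {v w : Fin n → Carrierᴹ} →
                 (∀ k → r k ≈ s k) → (∀ k → v k ≈ᴹ w k) → linComb L r v ≈ᴹ linComb L s w
  linComb-cong {zero}  r≈s v≈w = ≈ᴹ-refl
  linComb-cong {suc n} r≈s v≈w =
    +ᴹ-cong (*ₗ-cong (r≈s zero) (v≈w zero)) (linComb-cong (λ k → r≈s (suc k)) (λ k → v≈w (suc k)))

  linComb-congʳ : ∀ {n} (r : Fin n → Carrier) {v w : Fin n → Carrierᴹ} →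
                  (∀ k → v k ≈ᴹ w k) → linComb L r v ≈ᴹ linComb L r w
  linComb-congʳ r = linComb-cong (λ _ → ≈-refl)

  linComb-zeroˡ : ∀ {n} {r : Fin n → Carrier} (v : Fin n → Carrierᴹ) →
                  (∀ k → r k ≈ 0#) → linComb L r v ≈ᴹ 0ᴹ
  linComb-zeroˡ {zero}  v r≈0 = ≈ᴹ-refl
  linComb-zeroˡ {suc n} v r≈0 = ≈ᴹ-trans
    (+ᴹ-cong (≈ᴹ-trans (*ₗ-congʳ (r≈0 zero)) (*ₗ-zeroˡ _))
             (linComb-zeroˡ (λ k → v (suc k)) (λ k → r≈0 (suc k))))
    (+ᴹ-identityˡ 0ᴹ)

  linComb-zeroʳ : ∀ {n} (r : Fin n → Carrier) → linComb L r (λ _ → 0ᴹ) ≈ᴹ 0ᴹ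
  linComb-zeroʳ {zero}  r = ≈ᴹ-refl
  linComb-zeroʳ {suc n} r =
    ≈ᴹ-trans (+ᴹ-cong (*ₗ-zeroʳ _) (linComb-zeroʳ (λ k → r (suc k)))) (+ᴹ-identityˡ 0ᴹ)

  linComb-distrib-+ : ∀ {n} (r s : Fin n → Carrier) (v : Fin n → Carrierᴹ) →
                      linComb L (λ k → r k + s k) v ≈ᴹ linComb L r v +ᴹ linComb L s v
  linComb-distrib-+ {zero}  r s v = ≈ᴹ-sym (+ᴹ-identityˡ 0ᴹ)
  linComb-distrib-+ {suc n} r s v = ≈ᴹ-trans
    (+ᴹ-cong (*ₗ-distribʳ (v zero) (r zero) (s zero))
             (linComb-distrib-+ (λ k → r (suc k)) (λ k → s (suc k)) (λ k → v (suc k))))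
    (interchange _ _ _ _)

  *ₗ-distrib-linComb : ∀ {n} t (r : Fin n → Carrier) (v : Fin n → Carrierᴹ) →
                       t *ₗ linComb L r v ≈ᴹ linComb L (λ k → t * r k) v
  *ₗ-distrib-linComb {zero}  t r v = *ₗ-zeroʳ t
  *ₗ-distrib-linComb {suc n} t r v = ≈ᴹ-trans (*ₗ-distribˡ t _ _)
    (+ᴹ-cong (≈ᴹ-sym (*ₗ-assoc t (r zero) (v zero))) (*ₗ-distrib-linComb t (λ k → r (suc k)) (λ k → v (suc k))))

  linComb-*ₗ : ∀ {n} t (r : Fin n → Carrier) (v : Fin n → Carrierᴹ) →
               linComb L r (λ k → t *ₗ v k) ≈ᴹ t *ₗ linComb L r v
  linComb-*ₗ {zero}  t r v = ≈ᴹ-sym (*ₗ-zeroʳ t)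
  linComb-*ₗ {suc n} t r v = ≈ᴹ-trans
    (+ᴹ-cong (*ₗ-comm (r zero) t (v zero)) (linComb-*ₗ t (λ k → r (suc k)) (λ k → v (suc k))))
    (≈ᴹ-sym (*ₗ-distribˡ t _ _))

  linComb-split : ∀ m {n} (r : Fin (m +ℕ n) → Carrier) (v : Fin (m +ℕ n) → Carrierᴹ) →
    linComb L r v ≈ᴹ
    linComb L (λ i → r (i ↑ˡ n)) (λ i → v (i ↑ˡ n)) +ᴹ linComb L (λ j → r (m ↑ʳ j)) (λ j → v (m ↑ʳ j))
  linComb-split zero    r v = ≈ᴹ-sym (+ᴹ-identityˡ _)
  linComb-split (suc m) r v = ≈ᴹ-trans
    (+ᴹ-congˡ (linComb-split m (λ i → r (suc i)) (λ i → v (suc i))))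
    (≈ᴹ-sym (+ᴹ-assoc _ _ _))

  linComb-linComb : ∀ {n e} (r : Fin n → Carrier) (M : Fin n → Fin e → Carrier) (b : Fin e → Carrierᴹ) →
    linComb L r (λ k → linComb L (M k) b) ≈ᴹ linComb L (λ j → sum (λ k → r k * M k j)) b
  linComb-linComb {zero}  r M b = ≈ᴹ-sym (linComb-zeroˡ b (λ j → ≈-refl))
  linComb-linComb {suc n} r M b = ≈ᴹ-trans
    (+ᴹ-cong (*ₗ-distrib-linComb (r zero) (M zero) b) (linComb-linComb (λ k → r (suc k)) (λ k → M (suc k)) b))
    (≈ᴹ-sym (linComb-distrib-+ (λ j → r zero * M zero j) (λ j → sum (λ k → r (suc k) * M (suc k) j)) b))

  SpannedBy⇒dependent : ∀ {D} → SpannedBy L D → (v : Fin (suc D) → Carrierᴹ) →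
    ¬ ¬ (Σ (Fin (suc D) → Carrier) λ r → (∃ λ k → ¬ r k ≈ 0#) × linComb L r v ≈ᴹ 0ᴹ)
  SpannedBy⇒dependent {D} (b , spans) v = do
    (r , nontrivial , r-solves) ← underdetermined-solvable D coordinates
    return (r , nontrivial , (begin
      linComb L r v                                          ≈⟨ linComb-congʳ r (λ k → proj₂ (spans (v k))) ⟩
      linComb L r (λ k → linComb L (coordinates k) b)        ≈⟨ linComb-linComb r coordinates b ⟩
      linComb L (λ j → sum (λ k → r k * coordinates k j)) b  ≈⟨ linComb-zeroˡ b r-solves ⟩
      0ᴹ                                                     ∎))
    where
    coordinates : Fin (suc D) → Fin D → Carrier
    coordinates k = proj₁ (spans (v k))

  -- Σₖ cₖ tᵏ in Horner form.
  eval : ∀ {n} → (Fin n → Carrierᴹ) → Carrier → Carrierᴹ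
  eval {zero}  c t = 0ᴹ
  eval {suc n} c t = c zero +ᴹ t *ₗ eval (λ k → c (suc k)) t

  linComb-powers : ∀ {n} (r : Fin n → Carrier) (u : Fin n → Carrierᴹ) t →
                   linComb L r (λ k → (t ^ toℕ k) *ₗ u k) ≈ᴹ eval (λ k → r k *ₗ u k) t
  linComb-powers {zero}  r u t = ≈ᴹ-refl
  linComb-powers {suc n} r u t = +ᴹ-cong (*ₗ-congˡ (*ₗ-identityˡ (u zero))) (begin
    linComb L r′ (λ k → (t * t ^ toℕ k) *ₗ u (suc k))   ≈⟨ linComb-congʳ r′ (λ k → *ₗ-assoc t _ _) ⟩
    linComb L r′ (λ k → t *ₗ (t ^ toℕ k *ₗ u (suc k)))  ≈⟨ linComb-*ₗ t r′ _ ⟩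
    t *ₗ linComb L r′ (λ k → t ^ toℕ k *ₗ u (suc k))    ≈⟨ *ₗ-congˡ (linComb-powers r′ u′ t) ⟩
    t *ₗ eval (λ k → r′ k *ₗ u′ k) t                    ∎)
    where
    r′ = λ k → r (suc k)
    u′ = λ k → u (suc k)

  -- The quotient q of c by X − s, so that c(X) = c(s) + (X − s) q(X).
  quotient : ∀ {n} → Carrier → (Fin (suc n) → Carrierᴹ) → Fin n → Carrierᴹ
  quotient {suc n} s c zero    = eval (λ k → c (suc k)) s
  quotient {suc n} s c (suc k) = quotient s (λ j → c (suc j)) k

  eval-division : ∀ {n} (c : Fin (suc n) → Carrierᴹ) s t →
                  eval c t ≈ᴹ eval c s +ᴹ (t - s) *ₗ eval (quotient s c) t
  eval-division {zero} c s t = begin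
    c zero +ᴹ t *ₗ 0ᴹ                        ≈⟨ +ᴹ-congˡ (*ₗ-zeroʳ t) ⟩
    c zero +ᴹ 0ᴹ                             ≈⟨ +ᴹ-identityʳ _ ⟨
    (c zero +ᴹ 0ᴹ) +ᴹ 0ᴹ                     ≈⟨ +ᴹ-cong (+ᴹ-congˡ (*ₗ-zeroʳ s)) (*ₗ-zeroʳ (t - s)) ⟨
    (c zero +ᴹ s *ₗ 0ᴹ) +ᴹ (t - s) *ₗ 0ᴹ     ∎
  eval-division {suc n} c s t = begin
    c₀ +ᴹ t *ₗ Pt
      ≈⟨ +ᴹ-congˡ (*ₗ-congˡ (eval-division P s t)) ⟩
    c₀ +ᴹ t *ₗ (Ps +ᴹ (t - s) *ₗ Qt)
      ≈⟨ +ᴹ-congˡ (*ₗ-distribˡ t Ps _) ⟩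
    c₀ +ᴹ (t *ₗ Ps +ᴹ t *ₗ ((t - s) *ₗ Qt))
      ≈⟨ +ᴹ-congˡ (+ᴹ-cong t*Ps≈ (*ₗ-comm t (t - s) Qt)) ⟩
    c₀ +ᴹ ((s *ₗ Ps +ᴹ (t - s) *ₗ Ps) +ᴹ (t - s) *ₗ (t *ₗ Qt))
      ≈⟨ +ᴹ-congˡ (+ᴹ-assoc _ _ _) ⟩
    c₀ +ᴹ (s *ₗ Ps +ᴹ ((t - s) *ₗ Ps +ᴹ (t - s) *ₗ (t *ₗ Qt)))
      ≈⟨ +ᴹ-assoc _ _ _ ⟨
    (c₀ +ᴹ s *ₗ Ps) +ᴹ ((t - s) *ₗ Ps +ᴹ (t - s) *ₗ (t *ₗ Qt))
      ≈⟨ +ᴹ-congˡ (*ₗ-distribˡ (t - s) Ps _) ⟨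
    (c₀ +ᴹ s *ₗ Ps) +ᴹ (t - s) *ₗ (Ps +ᴹ t *ₗ Qt) ∎
    where
    c₀ = c zero
    P  = λ k → c (suc k)
    Pt = eval P t
    Ps = eval P s
    Qt = eval (quotient s P) t
    t*Ps≈ : t *ₗ Ps ≈ᴹ s *ₗ Ps +ᴹ (t - s) *ₗ Ps
    t*Ps≈ = ≈ᴹ-trans (*ₗ-congʳ (Field.sym F s+[t-s]≈t)) (*ₗ-distribʳ Ps s (t - s))
      where s+[t-s]≈t = Field.trans F (Field.+-comm F s (t - s)) (//-rightDividesˡ s t)

  quotient≈0⇒coefficients≈0 : ∀ {n} (c : Fin (suc n) → Carrierᴹ) s →
    (∀ k → quotient s c k ≈ᴹ 0ᴹ) → eval c s ≈ᴹ 0ᴹ → ∀ k → c k ≈ᴹ 0ᴹ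
  quotient≈0⇒coefficients≈0 {n} c s q≈0 c[s]≈0 zero = begin
    c zero                                  ≈⟨ +ᴹ-identityʳ _ ⟨
    c zero +ᴹ 0ᴹ                            ≈⟨ +ᴹ-congˡ (*ₗ-zeroʳ s) ⟨
    c zero +ᴹ s *ₗ 0ᴹ                       ≈⟨ +ᴹ-congˡ (*ₗ-congˡ (tail≈0 n q≈0)) ⟨
    c zero +ᴹ s *ₗ eval (λ k → c (suc k)) s ≈⟨ c[s]≈0 ⟩
    0ᴹ                                      ∎
    where
    tail≈0 : ∀ n {c : Fin (suc n) → Carrierᴹ} →
             (∀ k → quotient s c k ≈ᴹ 0ᴹ) → eval (λ k → c (suc k)) s ≈ᴹ 0ᴹ
    tail≈0 zero    _   = ≈ᴹ-refl
    tail≈0 (suc n) q≈0 = q≈0 zero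
  quotient≈0⇒coefficients≈0 {suc n} c s q≈0 _ (suc k) =
    quotient≈0⇒coefficients≈0 (λ j → c (suc j)) s (λ j → q≈0 (suc j)) (q≈0 zero) k

  roots⇒coefficients≈0 : ∀ n (c : Fin n → Carrierᴹ) (t : Fin n → Carrier) →
    (∀ i j → t i ≈ t j → i ≡ j) → (∀ i → eval c (t i) ≈ᴹ 0ᴹ) → ∀ k → c k ≈ᴹ 0ᴹ
  roots⇒coefficients≈0 zero    c t t-injective c[t]≈0 ()
  roots⇒coefficients≈0 (suc n) c t t-injective c[t]≈0 =
    quotient≈0⇒coefficients≈0 c (t zero)
      (roots⇒coefficients≈0 n (quotient (t zero) c) (λ i → t (suc i)) t′-injective q[t′]≈0)
      (c[t]≈0 zero)
    where
    t′-injective : ∀ i j → t (suc i) ≈ t (suc j) → i ≡ j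
    t′-injective i j ti≈tj with t-injective (suc i) (suc j) ti≈tj
    ... | refl = refl
    q[t′]≈0 : ∀ i → eval (quotient (t zero) c) (t (suc i)) ≈ᴹ 0ᴹ
    q[t′]≈0 i = *ₗ-cancelˡ ti-t0≉0 (begin
      (t (suc i) - t zero) *ₗ q                         ≈⟨ +ᴹ-identityˡ _ ⟨
      0ᴹ +ᴹ (t (suc i) - t zero) *ₗ q                   ≈⟨ +ᴹ-congʳ (c[t]≈0 zero) ⟨
      eval c (t zero) +ᴹ (t (suc i) - t zero) *ₗ q      ≈⟨ eval-division c (t zero) (t (suc i)) ⟨
      eval c (t (suc i))                                ≈⟨ c[t]≈0 (suc i) ⟩
      0ᴹ                                                ∎)
      where
      q = eval (quotient (t zero) c) (t (suc i))
      ti-t0≉0 : ¬ (t (suc i) - t zero) ≈ 0#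
      ti-t0≉0 ti-t0≈0 with t-injective (suc i) zero (x∙y⁻¹≈ε⇒x≈y _ _ ti-t0≈0)
      ... | ()

module DirectSumProperties {c ℓ : Level} {F : Field c ℓ} where
  open LinearCombinations using (linComb-cong; linComb-zeroʳ; linComb-split)

  module _ {a ℓa b ℓb : Level} (L : LieAlgebra F a ℓa) (M : LieAlgebra F b ℓb) where
    private
      module L = LieAlgebra L
      module M = LieAlgebra M
      module L⊕M = LieAlgebra (L ⊕ M)
      open Field F using (Carrier)

    linComb-⊕ : ∀ {n} (r : Fin n → Carrier) (v : Fin n → L⊕M.Carrierᴹ) →
      linComb (L ⊕ M) r v L⊕M.≈ᴹ (linComb L r (λ k → proj₁ (v k)) , linComb M r (λ k → proj₂ (v k)))
    linComb-⊕ {zero}  r v = L.≈ᴹ-refl , M.≈ᴹ-refl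
    linComb-⊕ {suc n} r v with linComb-⊕ (λ k → r (suc k)) (λ k → v (suc k))
    ... | ≈₁ , ≈₂ = L.+ᴹ-congˡ ≈₁ , M.+ᴹ-congˡ ≈₂

    SpannedBy-⊕ : ∀ {d₁ d₂} → SpannedBy L d₁ → SpannedBy M d₂ → SpannedBy (L ⊕ M) (d₁ +ℕ d₂)
    SpannedBy-⊕ {d₁} {d₂} (b₁ , spans₁) (b₂ , spans₂) = b₁′ ++ b₂′ , decompose
      where
      open import Relation.Binary.Reasoning.Setoid L⊕M.≈ᴹ-setoid
      b₁′ = λ i → b₁ i , M.0ᴹ
      b₂′ = λ j → L.0ᴹ , b₂ j

      decompose : ∀ z → Σ (Fin (d₁ +ℕ d₂) → Carrier) λ r → z L⊕M.≈ᴹ linComb (L ⊕ M) r (b₁′ ++ b₂′)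
      decompose (u , w) = r₁ ++ r₂ , L⊕M.≈ᴹ-sym (begin
        linComb (L ⊕ M) (r₁ ++ r₂) (b₁′ ++ b₂′)
          ≈⟨ linComb-split (L ⊕ M) d₁ (r₁ ++ r₂) (b₁′ ++ b₂′) ⟩
        linComb (L ⊕ M) (λ i → (r₁ ++ r₂) (i ↑ˡ d₂)) (λ i → (b₁′ ++ b₂′) (i ↑ˡ d₂)) L⊕M.+ᴹ
        linComb (L ⊕ M) (λ j → (r₁ ++ r₂) (d₁ ↑ʳ j)) (λ j → (b₁′ ++ b₂′) (d₁ ↑ʳ j))
          ≈⟨ L⊕M.+ᴹ-cong
               (linComb-cong (L ⊕ M) (λ i → Field.reflexive F (lookup-++ˡ r₁ r₂ i))
                                     (λ i → L⊕M.≈ᴹ-reflexive (lookup-++ˡ b₁′ b₂′ i)))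
               (linComb-cong (L ⊕ M) (λ j → Field.reflexive F (lookup-++ʳ r₁ r₂ j))
                                     (λ j → L⊕M.≈ᴹ-reflexive (lookup-++ʳ b₁′ b₂′ j))) ⟩
        linComb (L ⊕ M) r₁ b₁′ L⊕M.+ᴹ linComb (L ⊕ M) r₂ b₂′
          ≈⟨ L⊕M.+ᴹ-cong (linComb-⊕ r₁ b₁′) (linComb-⊕ r₂ b₂′) ⟩
        (linComb L r₁ b₁ , linComb M r₁ (λ _ → M.0ᴹ)) L⊕M.+ᴹ
        (linComb L r₂ (λ _ → L.0ᴹ) , linComb M r₂ b₂)
          ≈⟨ L.+ᴹ-cong (L.≈ᴹ-sym u≈) (linComb-zeroʳ L r₂)
           , M.+ᴹ-cong (linComb-zeroʳ M r₁) (M.≈ᴹ-sym w≈) ⟩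
        (u L.+ᴹ L.0ᴹ , M.0ᴹ M.+ᴹ w)
          ≈⟨ L.+ᴹ-identityʳ u , M.+ᴹ-identityˡ w ⟩
        (u , w) ∎)
        where
        r₁ = proj₁ (spans₁ u)
        u≈ = proj₂ (spans₁ u)
        r₂ = proj₁ (spans₂ w)
        w≈ = proj₂ (spans₂ w)

  SpannedBy-⨁ : ∀ {a ℓa d} m (g : Fin m → LieAlgebra F a ℓa) →
                (∀ i → SpannedBy (g i) d) → SpannedBy (⨁ m g) (m *ℕ d)
  SpannedBy-⨁ zero    g spans = (λ ()) , λ _ → (λ ()) , _
  SpannedBy-⨁ (suc m) g spans =
    SpannedBy-⊕ (g zero) (⨁ m g′) (spans zero) (SpannedBy-⨁ m g′ (λ i → spans (suc i)))
    where g′ = λ i → g (suc i)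

module TwistedGenerators {c ℓ a ℓa : Level} {F : Field c ℓ} (L M : LieAlgebra F a ℓa)
       (x y : LieAlgebra.Carrierᴹ L) (A B : LieAlgebra.Carrierᴹ M) where
  open Field F using (Carrier; _≈_; _*_; 1#; 0#; -_; *-comm; *-identityʳ; semiring; inverse)
  open import Data.Fin using (toℕ)
  open import Algebra.Properties.Semiring.Exp semiring using (_^_; ^-homo-*)
  private
    module L = LieAlgebra L
    module M = LieAlgebra M
    module L⊕M = LieAlgebra (L ⊕ M)
  open Grading L x y using (Homogeneous; h-x; h-y; h-0; h-+; h-*; h-[]; h-≈)

  Twisted : Carrier → L⊕M.Carrierᴹ → Set (c ⊔ a ⊔ ℓa)
  Twisted t = Generated (L ⊕ M) (x , A) (t L.*ₗ y , B)

  Homogeneous-lift : ∀ {n u} → Homogeneous n u → ∃ λ w → ∀ t → Twisted t ((t ^ n) L.*ₗ u , w)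
  Homogeneous-lift h-x = A , λ t → g-≈ (L.≈ᴹ-sym (L.*ₗ-identityˡ x) , M.≈ᴹ-refl) gen₁
  Homogeneous-lift h-y = B , λ t → g-≈ (L.*ₗ-congʳ (Field.sym F (*-identityʳ t)) , M.≈ᴹ-refl) gen₂
  Homogeneous-lift h-0 = M.0ᴹ , λ t → g-≈ (L.≈ᴹ-sym (L.*ₗ-zeroʳ _) , M.≈ᴹ-refl) g-0
  Homogeneous-lift (h-+ hu hv) with Homogeneous-lift hu | Homogeneous-lift hv
  ... | w , tw | w′ , tw′ =
    w M.+ᴹ w′ , λ t → g-≈ (L.≈ᴹ-sym (L.*ₗ-distribˡ _ _ _) , M.≈ᴹ-refl) (g-+ (tw t) (tw′ t))
  Homogeneous-lift (h-* r hu) with Homogeneous-lift hu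
  ... | w , tw = r M.*ₗ w , λ t → g-≈ (L.*ₗ-comm r _ _ , M.≈ᴹ-refl) (g-* r (tw t))
  Homogeneous-lift (h-[] {p} {q} hu hv) with Homogeneous-lift hu | Homogeneous-lift hv
  ... | w , tw | w′ , tw′ = M.[ w , w′ ] , λ t → g-≈ (bracket t , M.≈ᴹ-refl) (g-[] (tw t) (tw′ t))
    where
    bracket : ∀ t {u v} → L.[ (t ^ p) L.*ₗ u , (t ^ q) L.*ₗ v ] L.≈ᴹ (t ^ (p +ℕ q)) L.*ₗ L.[ u , v ]
    bracket t = L.≈ᴹ-trans (L.[]-*ˡ _ _ _) (L.≈ᴹ-trans (L.*ₗ-congˡ (L.[]-*ʳ _ _ _))
                  (L.≈ᴹ-trans (L.≈ᴹ-sym (L.*ₗ-assoc _ _ _)) (L.*ₗ-congʳ (Field.sym F (^-homo-* t p q)))))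
  Homogeneous-lift (h-≈ u≈v hu) with Homogeneous-lift hu
  ... | w , tw = w , λ t → g-≈ (L.*ₗ-congˡ u≈v , M.≈ᴹ-refl) (tw t)

  module _ (t : Carrier) (t≉0 : ¬ t ≈ 0#) where
    private
      t⁻¹ = proj₁ (inverse t t≉0)
      t⁻¹t≈1 = Field.trans F (*-comm t⁻¹ t) (proj₂ (inverse t t≉0))

    Generated-lift : ∀ {z} → Generated L x y z → ∃ λ w → Twisted t (z , w)
    Generated-lift gen₁ = A , gen₁
    Generated-lift gen₂ = t⁻¹ M.*ₗ B , g-≈ (t⁻¹[ty]≈y , M.≈ᴹ-refl) (g-* t⁻¹ gen₂)
      where
      t⁻¹[ty]≈y = L.≈ᴹ-trans (L.≈ᴹ-sym (L.*ₗ-assoc t⁻¹ t y))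
                             (L.≈ᴹ-trans (L.*ₗ-congʳ t⁻¹t≈1) (L.*ₗ-identityˡ y))
    Generated-lift g-0 = M.0ᴹ , g-0
    Generated-lift (g-+ g h) with Generated-lift g | Generated-lift h
    ... | w , tw | w′ , tw′ = w M.+ᴹ w′ , g-+ tw tw′
    Generated-lift (g-* r g) with Generated-lift g
    ... | w , tw = r M.*ₗ w , g-* r tw
    Generated-lift (g-[] g h) with Generated-lift g | Generated-lift h
    ... | w , tw | w′ , tw′ = M.[ w , w′ ] , g-[] tw tw′
    Generated-lift (g-≈ e g) with Generated-lift g
    ... | w , tw = w , g-≈ (e , M.≈ᴹ-refl) tw

    Twisted∩L : L.Carrierᴹ → Set (c ⊔ ℓ ⊔ a ⊔ ℓa)
    Twisted∩L u = Lift ℓ (Twisted t (u , M.0ᴹ))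

    Twisted∩L-isIdeal : (∀ z → Generated L x y z) → IsIdeal L Twisted∩L
    Twisted∩L-isIdeal generates = record
      { resp-≈  = λ u≈v (lift tu) → lift (g-≈ (u≈v , M.≈ᴹ-refl) tu)
      ; has-0   = lift g-0
      ; clos-+  = λ (lift tu) (lift tv) → lift (g-≈ (L.≈ᴹ-refl , M.+ᴹ-identityˡ M.0ᴹ) (g-+ tu tv))
      ; clos-*  = λ r (lift tu) → lift (g-≈ (L.≈ᴹ-refl , M.*ₗ-zeroʳ r) (g-* r tu))
      ; clos-[] = λ z (lift tu) → lift (g-≈ (L.≈ᴹ-refl , LieAlgebraProperties.[]-zeroʳ M _)
                                            (g-[] (proj₂ (Generated-lift (generates z))) tu))
      }

    Twisted∩L-full⇒Twisted-full : (∀ w → Generated M A B w) → (∀ u → Twisted∩L u) → ∀ z → Twisted t z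
    Twisted∩L-full⇒Twisted-full generatesᴹ all-in-Twisted∩L (u , w) =
      g-≈ (L.+ᴹ-identityʳ u , M.+ᴹ-identityˡ w) (g-+ (lower (all-in-Twisted∩L u)) (in-M (generatesᴹ w)))
      where
      open LieAlgebraProperties L using (x+-1x≈0)
      subtract-Twisted∩L : ∀ {u w} → Twisted t (u , w) → Twisted t (L.0ᴹ , w)
      subtract-Twisted∩L {u} {w} tuw =
        g-≈ (x+-1x≈0 u , M.≈ᴹ-trans (M.+ᴹ-congˡ (M.*ₗ-zeroʳ (- 1#))) (M.+ᴹ-identityʳ w))
            (g-+ tuw (g-* (- 1#) (lower (all-in-Twisted∩L u))))
      in-M : ∀ {w} → Generated M A B w → Twisted t (L.0ᴹ , w)
      in-M gen₁       = subtract-Twisted∩L gen₁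
      in-M gen₂       = subtract-Twisted∩L gen₂
      in-M g-0        = g-0
      in-M (g-+ g h)  = g-≈ (L.+ᴹ-identityˡ L.0ᴹ , M.≈ᴹ-refl) (g-+ (in-M g) (in-M h))
      in-M (g-* r g)  = g-≈ (L.*ₗ-zeroʳ r , M.≈ᴹ-refl) (g-* r (in-M g))
      in-M (g-[] g h) = g-≈ (LieAlgebraProperties.[]-zeroˡ L L.0ᴹ , M.≈ᴹ-refl) (g-[] (in-M g) (in-M h))
      in-M (g-≈ e g)  = g-≈ (L.≈ᴹ-refl , e) (in-M g)

  module _ {D : ℕ} (spannedᴹ : SpannedBy M D) (generates : ∀ z → Generated L x y z) (simple : IsSimple L)
           (t : Fin (suc D) → Carrier) (t-injective : ∀ i j → t i ≈ t j → i ≡ j) where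
    open Grading L x y using (homogeneous-nonzero)
    open LinearCombinations using (SpannedBy⇒dependent; roots⇒coefficients≈0; linComb-powers)
    open LieAlgebraProperties L using (*ₗ-cancelˡ)
    open LieAlgebraProperties using (Generated-linComb)
    open DirectSumProperties using (linComb-⊕)
    open ¬¬-Monad

    Twisted∩L-nonzero : ¬ (∀ i u → Twisted (t i) (u , M.0ᴹ) → u L.≈ᴹ L.0ᴹ)
    Twisted∩L-nonzero Twisted∩L≈0 = contradiction-in-¬¬ (λ ())
      where
      contradiction-in-¬¬ : ¬ ¬ ⊥
      contradiction-in-¬¬ = do
        nonzero ← ¬¬-pull (λ k → homogeneous-nonzero generates simple (toℕ {suc D} k))
        let u = λ k → proj₁ (nonzero k)
            lifted = λ k → Homogeneous-lift (proj₁ (proj₂ (nonzero k)))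
            w = λ k → proj₁ (lifted k)
        (r , (k , rk≉0) , Σrw≈0) ← SpannedBy⇒dependent M spannedᴹ w
        let polynomial-vanishes : ∀ i → LinearCombinations.eval L (λ k → r k L.*ₗ u k) (t i) L.≈ᴹ L.0ᴹ
            polynomial-vanishes i = L.≈ᴹ-trans (L.≈ᴹ-sym (linComb-powers L r u (t i)))
              (Twisted∩L≈0 i _
                (g-≈ (L⊕M.≈ᴹ-trans (linComb-⊕ L M r (λ k → (t i ^ toℕ k) L.*ₗ u k , w k))
                                   (L.≈ᴹ-refl , Σrw≈0))
                     (Generated-linComb (L ⊕ M) r (λ k → proj₂ (lifted k) (t i)))))
        return (proj₂ (proj₂ (nonzero k)) (*ₗ-cancelˡ rk≉0
          (roots⇒coefficients≈0 L (suc D) (λ k → r k L.*ₗ u k) t t-injective polynomial-vanishes k)))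

-- Two-generation of direct sums

module _ {c ℓ : Level} {F : Field c ℓ} where
  open Field F using (Carrier; _≈_; _-_; 0#)
  open DirectSumProperties using (SpannedBy-⨁)
  open import Data.Fin using (inject≤; inject₁; fromℕ)
  open import Data.Fin.Properties using (inject≤-injective; inject₁-injective; fromℕ≢inject₁)
  open import Algebra.Properties.AbelianGroup (Field.+-abelianGroup F)
    using (x∙y⁻¹≈ε⇒x≈y; //-rightDividesˡ)

  AtLeast-≤ : ∀ {n N} → n ≤ N → AtLeast N F → AtLeast n F
  AtLeast-≤ n≤N (e , e-injective) =
    (λ i → e (inject≤ i n≤N)) , λ i j ei≈ej → inject≤-injective n≤N n≤N i j (e-injective _ _ ei≈ej)

  AtLeast⇒distinct-nonzero : ∀ {n} → AtLeast (suc (suc n)) F →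
    Σ (Fin (suc n) → Carrier) λ t → (∀ i → ¬ t i ≈ 0#) × (∀ i j → t i ≈ t j → i ≡ j)
  AtLeast⇒distinct-nonzero {n} (e , e-injective) = t , t≉0 , t-injective
    where
    t : Fin (suc n) → Carrier
    t i = e (inject₁ i) - e (fromℕ (suc n))
    t≉0 : ∀ i → ¬ t i ≈ 0#
    t≉0 i ti≈0 = fromℕ≢inject₁ (≡.sym (e-injective _ _ (x∙y⁻¹≈ε⇒x≈y _ _ ti≈0)))
    t-injective : ∀ i j → t i ≈ t j → i ≡ j
    t-injective i j ti≈tj = inject₁-injective (e-injective _ _ (Field.trans F
      (Field.sym F (//-rightDividesˡ (e (fromℕ (suc n))) _))
      (Field.trans F (Field.+-congʳ F ti≈tj) (//-rightDividesˡ _ _))))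

  ∀⊎-Fin : ∀ {p q} n {P : Fin n → Set p} {Q : Set q} → (∀ i → P i ⊎ Q) → (∀ i → P i) ⊎ Q
  ∀⊎-Fin zero    P⊎Q = inj₁ (λ ())
  ∀⊎-Fin (suc n) P⊎Q with P⊎Q zero | ∀⊎-Fin n (λ i → P⊎Q (suc i))
  ... | inj₂ q  | _        = inj₂ q
  ... | inj₁ _  | inj₂ q   = inj₂ q
  ... | inj₁ P₀ | inj₁ Pₛ  = inj₁ λ where zero → P₀ ; (suc i) → Pₛ i

  module _ {a ℓa : Level} where

    TwoGenerated-⊕ : ∀ {D} (L M : LieAlgebra F a ℓa) → AtLeast (suc (suc D)) F → SpannedBy M D →
                     IsSimple L → TwoGenerated L → TwoGenerated M → TwoGenerated (L ⊕ M)
    TwoGenerated-⊕ {D} L M atLeast spannedᴹ simple (x , y , generates) (A , B , generatesᴹ) =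
      [ (λ Twisted∩L≈0 → contradiction (λ i u tu → Twisted∩L≈0 i u (lift tu))
                                       (Twisted∩L-nonzero spannedᴹ generates simple t t-injective))
      , id ]′ (∀⊎-Fin (suc D) Twisted∩L-zero⊎full)
      where
      open LieAlgebra L using (_≈ᴹ_; 0ᴹ)
      open TwistedGenerators L M x y A B
      t = proj₁ (AtLeast⇒distinct-nonzero atLeast)
      t≉0 = proj₁ (proj₂ (AtLeast⇒distinct-nonzero atLeast))
      t-injective = proj₂ (proj₂ (AtLeast⇒distinct-nonzero atLeast))
      Twisted∩L-zero⊎full : ∀ i → (∀ u → Twisted∩L (t i) (t≉0 i) u → u ≈ᴹ 0ᴹ) ⊎ TwoGenerated (L ⊕ M)
      Twisted∩L-zero⊎full i with proj₂ simple _ (Twisted∩L-isIdeal (t i) (t≉0 i) generates)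
      ... | inj₁ Twisted∩L≈0 = inj₁ Twisted∩L≈0
      ... | inj₂ Twisted∩L≡L =
        inj₂ (_ , _ , Twisted∩L-full⇒Twisted-full (t i) (t≉0 i) generatesᴹ Twisted∩L≡L)

    ⨁-TwoGenerated : ∀ {d} m (g : Fin m → LieAlgebra F a ℓa) → AtLeast (suc (suc (m *ℕ d))) F →
      (∀ i → SpannedBy (g i) d) → (∀ i → IsSimple (g i)) → (∀ i → TwoGenerated (g i)) →
      TwoGenerated (⨁ m g)
    ⨁-TwoGenerated zero    g atLeast spanned simple twoGenerated = _ , _ , λ _ → gen₁
    ⨁-TwoGenerated {d} (suc m) g atLeast spanned simple twoGenerated =
      TwoGenerated-⊕ (g zero) (⨁ m g′) atLeast′ (SpannedBy-⨁ m g′ (λ i → spanned (suc i)))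
        (simple zero) (twoGenerated zero)
        (⨁-TwoGenerated m g′ atLeast′
          (λ i → spanned (suc i)) (λ i → simple (suc i)) (λ i → twoGenerated (suc i)))
      where
      g′ = λ i → g (suc i)
      atLeast′ = AtLeast-≤ (s≤s (s≤s (ℕ.m≤n+m (m *ℕ d) d))) atLeast

lemmaD2 : ∀ {c ℓ a ℓa : Level} (m d : ℕ) →
    Σ ℕ λ N →
      (F : Field c ℓ) → AtLeast N F →
      (g : Fin m → LieAlgebra F a ℓa) →
      (∀ i → SpannedBy (g i) d) →
      (∀ i → IsSimple (g i)) →
      (∀ i → TwoGenerated (g i)) →
      TwoGenerated (⨁ m g)
lemmaD2 m d = suc (suc (m *ℕ d)) , λ F atLeast g → ⨁-TwoGenerated m g atLeast
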